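{- For every odd $n\ge 3$, the dispensing number of the cycle $C_n$ is $\vartheta(C_n)=1$.
   Context: An integer additive set-indexer (IASI) of a graph $G$ is an injective map $f:V(G)\to\mathcal{P}(\mathbb{N}_0)$ (finite subsets of non-negative integers) such that $f^+(uv)=f(u)+f(v)=\{a+b:a\in f(u),b\in f(v)\}$ is injective on $E(G)$. An AP-set is a set of at least three non-negative integers in arithmetic progression; its common difference is its deterministic index. An arithmetic IASI (AIASI) is an IASI for which all vertex and edge set-labels are AP-sets. For an edge, the integer ratio between the deterministic indices of its end vertices (larger over smaller) is its deterministic ratio. The dispensing number $\vartheta(G)$ is the minimum possible number of edges of $G$ that do not have a prime deterministic ratio (minimum over arithmetic IASIs of $G$). -}

module Defs where

open import Data.Nat using (ℕ; zero; suc; _+_; _*_; _≤_; _<_; _%_)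
open import Data.Nat.DivMod using (m%n<n)
open import Data.Nat.Primality using (Prime)
open import Data.Fin using (Fin; toℕ; fromℕ<)
open import Data.Product using (Σ; ∃; ∃-syntax; _×_; _,_)
open import Data.Sum using (_⊎_)
open import Relation.Binary.PropositionalEquality using (_≡_)
open import Relation.Nullary using (¬_)

Odd : ℕ → Set
Odd n = ∃[ k ] n ≡ suc (2 * k)

NSet : Set₁
NSet = ℕ → Set

SameSet : NSet → NSet → Set
SameSet P Q = ∀ x → (P x → Q x) × (Q x → P x)

record APData : Set where
  constructor ap
  field
    start : ℕ
    diff  : ℕ
    len   : ℕ
    diff≥1 : 1 ≤ diff
    len≥3  : 3 ≤ len
open APData public

⟦_⟧ : APData → NSet
⟦ A ⟧ x = ∃[ i ] (i < len A × x ≡ start A + i * diff A)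

IsAPSet : NSet → Set
IsAPSet P = ∃[ A ] SameSet P ⟦ A ⟧

_⊕_ : NSet → NSet → NSet
(P ⊕ Q) x = ∃[ a ] ∃[ b ] (P a × Q b × x ≡ a + b)

-- Cycle C_n on vertex set Fin n: edges are {i, i+1 mod n}, indexed by i.
next : ∀ {n} → Fin n → Fin n
next {suc m} i = fromℕ< (m%n<n (suc (toℕ i)) (suc m))

-- An arithmetic IASI of the cycle C_n. Every vertex label is an AP-set,
-- given by its AP data (the data is uniquely determined by the set).
record AIASI (n : ℕ) : Set₁ where
  field
    label : Fin n → APData
  edgeLabel : Fin n → NSet
  edgeLabel i = ⟦ label i ⟧ ⊕ ⟦ label (next i) ⟧
  field
    vertex-inj : ∀ u v → SameSet ⟦ label u ⟧ ⟦ label v ⟧ → u ≡ v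
    edge-inj   : ∀ i j → SameSet (edgeLabel i) (edgeLabel j) → i ≡ j
    edge-AP    : ∀ i → IsAPSet (edgeLabel i)
open AIASI public

-- The deterministic ratio of an edge with end-vertex deterministic indices
-- d₁, d₂ is prime: the larger is p times the smaller for a prime p.
PrimeRatio : ℕ → ℕ → Set
PrimeRatio d₁ d₂ = ∃[ p ] (Prime p × (d₂ ≡ p * d₁ ⊎ d₁ ≡ p * d₂))

NonPrimeEdge : ∀ {n} → AIASI n → Fin n → Set
NonPrimeEdge f i = ¬ PrimeRatio (diff (label f i)) (diff (label f (next i)))

-- ϑ(C_n) = 1: some AIASI has exactly one edge without prime deterministic
-- ratio, and every AIASI has at least one such edge.
DispensingNumberIsOne : ℕ → Set₁
DispensingNumberIsOne n =
  (Σ (AIASI n) λ f → ∃[ e ] (NonPrimeEdge f e × (∀ e′ → NonPrimeEdge f e′ → e′ ≡ e)))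
  × (∀ (f : AIASI n) → ∃[ e ] NonPrimeEdge f e)

module Submission where

-- Vertex i gets the
-- AP-set {i, i + δ, i + 2δ} with δ = 1 for even i and δ = 2 for odd i.
-- Along the path 0 → 1 → … → 2k the parities alternate, so these edges have
-- deterministic ratio 2; only the closing edge 2k → 0 joins two even vertices
-- and has ratio 1.  Every edge label is an interval (a progression of step 1
-- summed with a progression whose step does not exceed its length), and the
-- labels are told apart by their least elements: i for vertices, and
-- i + (i+1) (odd) or 2k (even) for edges.
--
-- Let Ω(d) be the number of
-- prime factors of d counted with multiplicity.  Across an edge with prime
-- ratio Ω changes by exactly one, so the parity of Ω would be a proper
-- 2-colouring of C_n, which is impossible for an odd cycle.  As prime ratio
-- is decidable, the failing edge can be exhibited.

open import Defs
open import Data.Nat using (ℕ; _≤_)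
open import Data.Nat.Base using (zero; suc; _+_; _*_; _∸_; _%_; _<_; s≤s; z≤n; >-nonZero; s≤s⁻¹)
open import Data.Nat.Properties
open import Data.Nat.DivMod using (m%n<n; n%n≡0; m<n⇒m%n≡m)
open import Data.Nat.Divisibility using (divides; _∣?_)
open import Data.Nat.Primality using (Prime; prime?; prime[2]; ¬prime[1])
open import Data.Nat.Primality.Factorisation using (PrimeFactorisation; factorise; factorisationUnique; factors)
open import Data.Nat.Tactic.RingSolver using (solve-∀)
open import Data.List.Base using (_∷_; length)
open import Data.List.Relation.Unary.All using (_∷_)
open import Data.List.Relation.Binary.Permutation.Propositional.Properties using (↭-length)
open import Data.Fin.Base using (Fin; toℕ; fromℕ)
import Data.Fin.Base as Fin
open import Data.Fin.Properties using (toℕ-injective; toℕ-fromℕ<; toℕ<n; toℕ-fromℕ; ¬∀⟶∃¬)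
open import Data.Bool.Base using (Bool; true; false; not)
open import Data.Bool.Properties using (not-involutive)
open import Function.Base using (_∘_)
open import Data.Product using (∃-syntax; _×_; _,_; proj₁; proj₂)
open import Data.Sum using (_⊎_; inj₁; inj₂; reduce)
open import Relation.Nullary using (¬_; Dec; yes; no; contradiction)
open import Relation.Binary.PropositionalEquality

flips : ℕ → Bool → Bool
flips zero    b = b
flips (suc m) b = not (flips m b)

-- isEven m is true exactly for even m; successive numbers have opposite parity
-- definitionally, which is what the alternating colourings below use.
isEven : ℕ → Bool
isEven m = flips m true

flips-double : ∀ k b → flips (2 * k) b ≡ b
flips-double zero    b = refl
flips-double (suc k) b = begin
  flips (2 * suc k) b          ≡⟨ cong (λ m → flips m b) (*-suc 2 k) ⟩
  not (not (flips (2 * k) b))  ≡⟨ cong (λ c → not (not c)) (flips-double k b) ⟩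
  not (not b)                  ≡⟨ not-involutive b ⟩
  b                            ∎
  where open ≡-Reasoning

-- Needed to separate the odd keys of the forward edges from the even key 2k.
odd≢even : ∀ a k → suc (2 * a) ≢ 2 * k
odd≢even a k 1+2a≡2k with begin
  false                  ≡⟨ cong not (sym (flips-double a true)) ⟩
  isEven (suc (2 * a))   ≡⟨ cong isEven 1+2a≡2k ⟩
  isEven (2 * k)         ≡⟨ flips-double k true ⟩
  true                   ∎
  where open ≡-Reasoning
... | ()

not-fixed : ∀ b → ¬ (not b ≡ b)
not-fixed true  ()
not-fixed false ()

IsLeast : NSet → ℕ → Set
IsLeast P m = P m × (∀ x → P x → m ≤ x)

least-unique : ∀ {P Q p q} → IsLeast P p → IsLeast Q q → SameSet P Q → p ≡ q
least-unique (Pp , p-least) (Qq , q-least) P≈Q =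
  ≤-antisym (p-least _ (proj₂ (P≈Q _) Qq)) (q-least _ (proj₁ (P≈Q _) Pp))

least-AP : ∀ A → IsLeast ⟦ A ⟧ (start A)
least-AP A =
  (0 , ≤-trans (s≤s z≤n) (len≥3 A) , sym (+-identityʳ (start A))) ,
  λ { x (i , _ , refl) → m≤m+n (start A) (i * diff A) }

least-⊕ : ∀ {P Q p q} → IsLeast P p → IsLeast Q q → IsLeast (P ⊕ Q) (p + q)
least-⊕ {p = p} {q} (Pp , p-least) (Qq , q-least) =
  (p , q , Pp , Qq , refl) ,
  λ { x (a , b , Pa , Qb , refl) → +-mono-≤ (p-least a Pa) (q-least b Qb) }

-- The progression with first term s, common difference d and n terms;
-- ⟦ A ⟧ is definitionally Progression (start A) (diff A) (len A).
Progression : ℕ → ℕ → ℕ → NSet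
Progression s d n x = ∃[ i ] (i < n × x ≡ s + i * d)

-- Sumsets are commutative and set equality is transitive: used to reduce
-- an edge label with step 1 at its far end to one with step 1 at its near end.
⊕-comm : ∀ P Q → SameSet (P ⊕ Q) (Q ⊕ P)
⊕-comm P Q x = swap , swap
  where
  swap : ∀ {P Q} → (P ⊕ Q) x → (Q ⊕ P) x
  swap (a , b , Pa , Qb , x≡a+b) = b , a , Qb , Pa , trans x≡a+b (+-comm a b)

SameSet-trans : ∀ {P Q R} → SameSet P Q → SameSet Q R → SameSet P R
SameSet-trans P≈Q Q≈R x =
  (λ Px → proj₁ (Q≈R x) (proj₁ (P≈Q x) Px)) , (λ Rx → proj₂ (P≈Q x) (proj₂ (Q≈R x) Rx))

translates-cover : ∀ {l d} → d ≤ l → ∀ m k → k < l + m * d →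
                   ∃[ i ] ∃[ j ] (i < l × j < suc m × k ≡ i + j * d)
translates-cover d≤l zero k k<l =
  k , 0 , subst (k <_) (+-identityʳ _) k<l , s≤s z≤n , sym (+-identityʳ k)
translates-cover {l} {d} d≤l (suc m) k k<bound with k <? l + m * d
... | yes k<l+md =
  let i , j , i<l , j<1+m , k≡ = translates-cover d≤l m k k<l+md
  in  i , j , i<l , m<n⇒m<1+n j<1+m , k≡
... | no k≮l+md = k ∸ suc m * d , suc m , i<l , n<1+n (suc m) , sym (m∸n+n≡m shift≤k)
  where
  shift≤k : suc m * d ≤ k
  shift≤k = ≤-trans (+-monoˡ-≤ (m * d) d≤l) (≮⇒≥ k≮l+md)
  i<l : k ∸ suc m * d < l
  i<l = subst (k ∸ suc m * d <_) (m+n∸n≡m l (suc m * d)) (∸-monoˡ-< k<bound shift≤k)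

interval⊕progression : ∀ a b l d m → d ≤ l →
  SameSet (Progression a 1 l ⊕ Progression b d (suc m)) (Progression (a + b) 1 (l + m * d))
interval⊕progression a b l d m d≤l x = into , outof
  where
  regroup : ∀ a b i j d → (a + i * 1) + (b + j * d) ≡ (a + b) + (i + j * d) * 1
  regroup = solve-∀
  into : (Progression a 1 l ⊕ Progression b d (suc m)) x → Progression (a + b) 1 (l + m * d) x
  into (_ , _ , (i , i<l , refl) , (j , j<1+m , refl) , refl) =
    i + j * d , +-mono-<-≤ i<l (*-monoˡ-≤ d (s≤s⁻¹ j<1+m)) , regroup a b i j d
  outof : Progression (a + b) 1 (l + m * d) x → (Progression a 1 l ⊕ Progression b d (suc m)) x
  outof (k , k<bound , refl) with translates-cover d≤l m k k<bound
  ... | i , j , i<l , j<1+m , refl =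
    a + i * 1 , b + j * d , (i , i<l , refl) , (j , j<1+m , refl) , sym (regroup a b i j d)

no-prime-ratio-diagonal : ∀ d → 1 ≤ d → ¬ PrimeRatio d d
no-prime-ratio-diagonal (suc d) _ (p , p-prime , d≡pd) = ¬prime[1] (subst Prime p≡1 p-prime)
  where
  p≡1 : p ≡ 1
  p≡1 = *-cancelʳ-≡ p 1 (suc d) (sym (trans (+-identityʳ (suc d)) (reduce d≡pd)))

prime-multiple? : ∀ d₁ d₂ → 1 ≤ d₁ → Dec (∃[ p ] (Prime p × d₂ ≡ p * d₁))
prime-multiple? (suc d) d₂ _ with suc d ∣? d₂
... | no ∤ = no λ { (p , _ , e) → ∤ (divides p e) }
... | yes (divides q d₂≡qd) with prime? q
...   | yes q-prime = yes (q , q-prime , d₂≡qd)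
...   | no ¬q-prime = no λ { (p , p-prime , d₂≡pd) →
          ¬q-prime (subst Prime (*-cancelʳ-≡ p q (suc d) (trans (sym d₂≡pd) d₂≡qd)) p-prime) }

prime-ratio? : ∀ d₁ d₂ → 1 ≤ d₁ → 1 ≤ d₂ → Dec (PrimeRatio d₁ d₂)
prime-ratio? d₁ d₂ 1≤d₁ 1≤d₂ with prime-multiple? d₁ d₂ 1≤d₁ | prime-multiple? d₂ d₁ 1≤d₂
... | yes (p , p-prime , e) | _ = yes (p , p-prime , inj₁ e)
... | no _ | yes (p , p-prime , e) = yes (p , p-prime , inj₂ e)
... | no ¬up | no ¬down =
  no λ { (p , p-prime , inj₁ e) → ¬up (p , p-prime , e) ; (p , p-prime , inj₂ e) → ¬down (p , p-prime , e) }

Ω : ∀ d → 1 ≤ d → ℕ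
Ω d 1≤d = length (factors (factorise d {{>-nonZero 1≤d}}))

-- Multiplying by a prime adds one prime factor (uniqueness of factorisation).
Ω-prime-multiple : ∀ {d₁ d₂ p} (h₁ : 1 ≤ d₁) (h₂ : 1 ≤ d₂) → Prime p → d₂ ≡ p * d₁ →
                   Ω d₂ h₂ ≡ suc (Ω d₁ h₁)
Ω-prime-multiple {d₁} {d₂} {p} h₁ h₂ p-prime d₂≡pd₁ =
  ↭-length (factorisationUnique (factorise d₂ {{>-nonZero h₂}}) extended)
  where
  F₁ : PrimeFactorisation d₁
  F₁ = factorise d₁ {{>-nonZero h₁}}
  extended : PrimeFactorisation d₂
  extended = record
    { factors = p ∷ factors F₁
    ; isFactorisation = trans d₂≡pd₁ (cong (p *_) (PrimeFactorisation.isFactorisation F₁))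
    ; factorsPrime = p-prime ∷ PrimeFactorisation.factorsPrime F₁
    }

prime-ratio-flips-parity : ∀ {d₁ d₂} (h₁ : 1 ≤ d₁) (h₂ : 1 ≤ d₂) → PrimeRatio d₁ d₂ →
                           isEven (Ω d₂ h₂) ≡ not (isEven (Ω d₁ h₁))
prime-ratio-flips-parity h₁ h₂ (_ , p-prime , inj₁ up) =
  cong isEven (Ω-prime-multiple h₁ h₂ p-prime up)
prime-ratio-flips-parity h₁ h₂ (_ , p-prime , inj₂ down) =
  trans (sym (not-involutive _)) (cong (not ∘ isEven) (sym (Ω-prime-multiple h₂ h₁ p-prime down)))

data EdgeView (N : ℕ) (i : Fin (suc N)) : Set where
  forward : toℕ i < N → toℕ (next i) ≡ suc (toℕ i) → EdgeView N i
  closing : toℕ i ≡ N → toℕ (next i) ≡ 0 → EdgeView N i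

edgeView : ∀ {N} (i : Fin (suc N)) → EdgeView N i
edgeView {N} i = classify (m≤n⇒m<n∨m≡n (s≤s⁻¹ (toℕ<n i)))
  where
  next-is : toℕ (next i) ≡ suc (toℕ i) % suc N
  next-is = toℕ-fromℕ< (m%n<n (suc (toℕ i)) (suc N))
  classify : toℕ i < N ⊎ toℕ i ≡ N → EdgeView N i
  classify (inj₁ i<N) = forward i<N (trans next-is (m<n⇒m%n≡m (s≤s i<N)))
  classify (inj₂ i≡N) =
    closing i≡N (trans next-is (trans (cong (λ m → suc m % suc N) i≡N) (n%n≡0 (suc N))))

walk : ∀ {N} → ℕ → Fin (suc N)
walk zero    = Fin.zero
walk (suc m) = next (walk m)

walk-position : ∀ {N} m → m ≤ N → toℕ (walk {N} m) ≡ m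
walk-position zero    _ = refl
walk-position {N} (suc m) 1+m≤N with edgeView (walk {N} m)
... | forward _ steps = trans steps (cong suc (walk-position m (≤-trans (n≤1+n m) 1+m≤N)))
... | closing at-N _  = contradiction (trans (sym (walk-position m (<⇒≤ 1+m≤N))) at-N) (<⇒≢ 1+m≤N)

walk-returns : ∀ N → walk {N} (suc N) ≡ Fin.zero
walk-returns N with edgeView (walk {N} N)
... | forward before-N _ = contradiction (walk-position N ≤-refl) (<⇒≢ before-N)
... | closing _ back     = toℕ-injective back

colour-alternates : ∀ {N} (c : Fin (suc N) → Bool) → (∀ v → c (next v) ≡ not (c v)) →
                    ∀ m → c (walk m) ≡ flips m (c Fin.zero)
colour-alternates c proper zero    = refl
colour-alternates c proper (suc m) = trans (proper (walk m)) (cong not (colour-alternates c proper m))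

odd-cycle-not-bipartite : ∀ k (c : Fin (suc (2 * k)) → Bool) → ¬ (∀ v → c (next v) ≡ not (c v))
odd-cycle-not-bipartite k c proper = not-fixed (c Fin.zero) (begin
  not (c Fin.zero)                        ≡⟨ cong not (sym (flips-double k (c Fin.zero))) ⟩
  flips (suc (2 * k)) (c Fin.zero)        ≡⟨ sym (colour-alternates c proper (suc (2 * k))) ⟩
  c (walk (suc (2 * k)))                  ≡⟨ cong c (walk-returns (2 * k)) ⟩
  c Fin.zero                              ∎)
  where open ≡-Reasoning

step : Bool → ℕ
step true  = 1
step false = 2

1≤step : ∀ x → 1 ≤ step x
1≤step true  = s≤s z≤n
1≤step false = s≤s z≤n

step≤3 : ∀ x → step x ≤ 3
step≤3 true  = s≤s z≤n
step≤3 false = s≤s (s≤s z≤n)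

vertexAP : ℕ → Bool → APData
vertexAP a x = ap a (step x) 3 (1≤step x) ≤-refl

step-ratio : ∀ x → PrimeRatio (step x) (step (not x))
step-ratio true  = 2 , prime[2] , inj₁ refl
step-ratio false = 2 , prime[2] , inj₂ refl

-- If one end has step 1, the edge label is an interval, hence an AP-set.
edge-sumset-AP : ∀ a b x y → x ≡ true ⊎ y ≡ true → IsAPSet (⟦ vertexAP a x ⟧ ⊕ ⟦ vertexAP b y ⟧)
edge-sumset-AP a b true  y    _ =
  ap (a + b) 1 (3 + 2 * step y) (s≤s z≤n) (m≤m+n 3 _) , interval⊕progression a b 3 (step y) 2 (step≤3 y)
edge-sumset-AP a b false true _ with edge-sumset-AP b a true false (inj₁ refl)
... | A , swapped≈A = A , SameSet-trans (⊕-comm _ _) swapped≈A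
edge-sumset-AP a b false false (inj₁ ())
edge-sumset-AP a b false false (inj₂ ())

module Construction (k : ℕ) where

  N : ℕ
  N = 2 * k

  colour : Fin (suc N) → Bool
  colour i = isEven (toℕ i)

  vertexLabel : Fin (suc N) → APData
  vertexLabel i = vertexAP (toℕ i) (colour i)

  forward-alternates : ∀ i → toℕ (next i) ≡ suc (toℕ i) → colour (next i) ≡ not (colour i)
  forward-alternates i steps = cong isEven steps

  closing-even : ∀ i → toℕ i ≡ N → toℕ (next i) ≡ 0 → colour i ≡ true × colour (next i) ≡ true
  closing-even i at-N back = trans (cong isEven at-N) (flips-double k true) , cong isEven back

  -- Every edge has an even end, i.e. an end with step 1.
  edge-label-AP : ∀ i → IsAPSet (⟦ vertexLabel i ⟧ ⊕ ⟦ vertexLabel (next i) ⟧)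
  edge-label-AP i = edge-sumset-AP _ _ (colour i) (colour (next i)) (one-end-even (edgeView i))
    where
    one-end-even : EdgeView N i → colour i ≡ true ⊎ colour (next i) ≡ true
    one-end-even (forward _ steps) with colour i | forward-alternates i steps
    ... | true  | _    = inj₁ refl
    ... | false | next-even = inj₂ next-even
    one-end-even (closing at-N back) = inj₁ (proj₁ (closing-even i at-N back))

  key : Fin (suc N) → ℕ
  key i = toℕ i + toℕ (next i)

  least-edge : ∀ i → IsLeast (⟦ vertexLabel i ⟧ ⊕ ⟦ vertexLabel (next i) ⟧) (key i)
  least-edge i = least-⊕ (least-AP (vertexLabel i)) (least-AP (vertexLabel (next i)))

  KeyView : Fin (suc N) → Set
  KeyView i = (key i ≡ suc (2 * toℕ i)) ⊎ (toℕ i ≡ N × key i ≡ N)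

  key-view : ∀ i → EdgeView N i → KeyView i
  key-view i (forward _ steps) = inj₁ (trans (cong (toℕ i +_) steps) (consecutive-sum (toℕ i)))
    where
    consecutive-sum : ∀ m → m + suc m ≡ suc (2 * m)
    consecutive-sum = solve-∀
  key-view i (closing at-N back) = inj₂ (at-N , trans (cong₂ _+_ at-N back) (+-identityʳ N))

  key-injective : ∀ i j → key i ≡ key j → i ≡ j
  key-injective i j same = toℕ-injective (compare (key-view i (edgeView i)) (key-view j (edgeView j)))
    where
    compare : KeyView i → KeyView j → toℕ i ≡ toℕ j
    compare (inj₁ ki) (inj₁ kj) = *-cancelˡ-≡ _ _ 2 (suc-injective (trans (sym ki) (trans same kj)))
    compare (inj₁ ki) (inj₂ (_ , kj)) = contradiction (trans (sym ki) (trans same kj)) (odd≢even (toℕ i) k)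
    compare (inj₂ (_ , ki)) (inj₁ kj) = contradiction (trans (sym kj) (trans (sym same) ki)) (odd≢even (toℕ j) k)
    compare (inj₂ (i≡N , _)) (inj₂ (j≡N , _)) = trans i≡N (sym j≡N)

  labelling : AIASI (suc N)
  labelling = record
    { label      = vertexLabel
    ; vertex-inj = λ u v same →
        toℕ-injective (least-unique (least-AP (vertexLabel u)) (least-AP (vertexLabel v)) same)
    ; edge-inj   = λ i j same → key-injective i j (least-unique (least-edge i) (least-edge j) same)
    ; edge-AP    = edge-label-AP
    }

  forward-good : ∀ i → toℕ (next i) ≡ suc (toℕ i) → ¬ NonPrimeEdge labelling i
  forward-good i steps bad =
    bad (subst (λ c → PrimeRatio (step (colour i)) (step c))
               (sym (forward-alternates i steps)) (step-ratio (colour i)))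

  closing-edge : Fin (suc N)
  closing-edge = fromℕ N

  closing-edge-bad : NonPrimeEdge labelling closing-edge
  closing-edge-bad with edgeView closing-edge
  ... | forward before-N _ = contradiction (toℕ-fromℕ N) (<⇒≢ before-N)
  ... | closing at-N back with closing-even closing-edge at-N back
  ...   | even₁ , even₂ =
    no-prime-ratio-diagonal 1 (s≤s z≤n) ∘ subst₂ PrimeRatio (cong step even₁) (cong step even₂)

  only-bad-edge : ∀ e → NonPrimeEdge labelling e → e ≡ closing-edge
  only-bad-edge e bad with edgeView e
  ... | forward _ steps = contradiction bad (forward-good e steps)
  ... | closing at-N _  = toℕ-injective (trans at-N (sym (toℕ-fromℕ N)))

every-AIASI-has-bad-edge : ∀ k (f : AIASI (suc (2 * k))) → ∃[ e ] NonPrimeEdge f e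
every-AIASI-has-bad-edge k f =
  ¬∀⟶∃¬ _ _ (λ e → prime-ratio? _ _ (positive e) (positive (next e))) not-all-prime
  where
  positive : ∀ v → 1 ≤ diff (label f v)
  positive v = diff≥1 (label f v)
  not-all-prime : ¬ (∀ e → PrimeRatio (diff (label f e)) (diff (label f (next e))))
  not-all-prime all-prime =
    odd-cycle-not-bipartite k (λ v → isEven (Ω _ (positive v)))
      (λ v → prime-ratio-flips-parity (positive v) (positive (next v)) (all-prime v))

proposition3p3 : ∀ (n : ℕ) → Odd n → 3 ≤ n → DispensingNumberIsOne n
proposition3p3 .(suc (2 * k)) (k , refl) _ =
  (labelling , closing-edge , closing-edge-bad , only-bad-edge) , every-AIASI-has-bad-edge k
  where open Construction k
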